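{- Run Unit-Flow on inputs $(G,\Delta,U,h,w)$ with $w\ge 2$ and $\Delta(v)\le w\,d(v)$ for all $v$. Upon termination, the pre-flow $f$ and the labels $l$ satisfy: (a) if $l(v)=h$, then $w\,d(v)\ge f(v)\ge d(v)$; (b) if $h-1\ge l(v)\ge 1$, then $w\,d(v)\ge f(v)=d(v)$; (c) if $l(v)=0$, then $f(v)\le d(v)$.
   Context: $G=(V,E)$ is an undirected multigraph without self-loops, $d(v)$ the degree of $v$. Unit-Flow$(G,\Delta,U,h,w)$: inputs are a source function $\Delta:V\to\mathbb{Z}_{\ge 0}$, integer edge capacity $U>0$, integer label bound $h$, integer $w\ge 2$. Each vertex $v$ is a sink of capacity $d(v)$. It maintains a pre-flow $f$ with $f(v,u)=-f(u,v)$, $|f(v,u)|\le U$ per edge, residual capacity $r_f(v,u)=U-f(v,u)$, supply $f(v)=\Delta(v)+\sum_u f(u,v)$, excess $\operatorname{ex}(v)=\max(f(v)-d(v),0)$, and integer labels $l(v)$, initially $0$ (with $f\equiv0$), plus a current-edge pointer per vertex initially at the first edge of its incidence list. A vertex is active if $l(v)<h$ and $\operatorname{ex}(v)>0$. While some vertex is active: take an active $v$ of minimum label with current edge $\{v,u\}$; if $r_f(v,u)>0$ and $l(v)=l(u)+1$, push $\psi=\min(\operatorname{ex}(v),r_f(v,u),w\,d(u)-f(u))$ units from $v$ to $u$; otherwise advance the current edge, or if it was the last edge, increase $l(v)$ by $1$ and reset the pointer to the first edge. Stop when no vertex is active. -}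

module Defs where

open import Data.Nat as ℕ using (ℕ; zero; suc)
open import Data.Integer as ℤ using (ℤ; +_; -_; _⊔_; _⊓_)
open import Data.Fin using (Fin; _≟_)
open import Data.Product using (_×_; _,_; proj₁; proj₂)
open import Data.Sum using (_⊎_)
open import Data.List using (List; []; _∷_; length; map)
open import Data.List.Membership.Propositional using (_∈_)
open import Data.List.Relation.Unary.Unique.Propositional using (Unique)
open import Data.Maybe using (Maybe; just; nothing)
open import Data.Bool using (if_then_else_)
open import Relation.Nullary using (¬_)
open import Relation.Nullary.Decidable using (⌊_⌋)
open import Relation.Binary.PropositionalEquality using (_≡_; _≢_)
open import Relation.Binary.Construct.Closure.ReflexiveTransitive using (Star)
open import Function.Bundles using (_⇔_)

-- An undirected loopless multigraph on vertices Fin n with edges Fin m.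
record Graph : Set where
  field
    n m          : ℕ
    ends         : Fin m → Fin n × Fin n
    loopless     : ∀ e → proj₁ (ends e) ≢ proj₂ (ends e)
    inc          : Fin n → List (Fin m)
    inc-unique   : ∀ v → Unique (inc v)
    inc-complete : ∀ v e → (e ∈ inc v) ⇔ (v ≡ proj₁ (ends e) ⊎ v ≡ proj₂ (ends e))

sumℤ : List ℤ → ℤ
sumℤ []       = + 0
sumℤ (x ∷ xs) = x ℤ.+ sumℤ xs

nth : {A : Set} → List A → ℕ → Maybe A
nth []       _       = nothing
nth (x ∷ xs) zero    = just x
nth (x ∷ xs) (suc k) = nth xs k

-- State of Unit-Flow: the flow on each edge e (oriented from proj₁ (ends e)
-- to proj₂ (ends e)), labels, and current-edge pointers (index into inc v).
record State (G : Graph) : Set where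
  constructor ⟨_,_,_⟩
  open Graph G
  field
    flow  : Fin m → ℤ
    label : Fin n → ℕ
    ptr   : Fin n → ℕ

module UnitFlow (G : Graph) (Δ : Fin (Graph.n G) → ℕ) (U h w : ℕ) where
  open Graph G
  open State

  d : Fin n → ℕ
  d v = length (inc v)

  isTail : Fin n → Fin m → Data.Bool.Bool
  isTail v e = ⌊ v ≟ proj₁ (ends e) ⌋

  other : Fin n → Fin m → Fin n
  other v e = if isTail v e then proj₂ (ends e) else proj₁ (ends e)

  flowFrom : State G → Fin n → Fin m → ℤ
  flowFrom s v e = if isTail v e then flow s e else - flow s e

  res : State G → Fin n → Fin m → ℤ
  res s v e = + U ℤ.- flowFrom s v e

  -- supply f(v) = Δ(v) + Σ_u f(u,v)
  supply : State G → Fin n → ℤ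
  supply s v = + Δ v ℤ.+ sumℤ (map (λ e → - flowFrom s v e) (inc v))

  ex : State G → Fin n → ℤ
  ex s v = (supply s v ℤ.- + d v) ⊔ + 0

  Active : State G → Fin n → Set
  Active s v = (label s v ℕ.< h) × (+ 0 ℤ.< ex s v)

  MinActive : State G → Fin n → Set
  MinActive s v = Active s v × (∀ x → Active s x → label s v ℕ.≤ label s x)

  addFlow : State G → Fin n → Fin m → ℤ → (Fin m → ℤ)
  addFlow s v e a e′ =
    if ⌊ e′ ≟ e ⌋
      then (if isTail v e then flow s e ℤ.+ a else flow s e ℤ.- a)
      else flow s e′

  upd : {A : Set} → (Fin n → A) → Fin n → A → (Fin n → A)
  upd g v a x = if ⌊ x ≟ v ⌋ then a else g x

  Admissible : State G → Fin n → Fin m → Set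
  Admissible s v e = (+ 0 ℤ.< res s v e) × (label s v ≡ suc (label s (other v e)))

  data Step : State G → State G → Set where
    push : ∀ s v e → MinActive s v → nth (inc v) (ptr s v) ≡ just e →
           Admissible s v e →
           let u = other v e
               ψ = ex s v ⊓ (res s v e ⊓ (+ (w ℕ.* d u) ℤ.- supply s u))
           in Step s ⟨ addFlow s v e ψ , label s , ptr s ⟩
    advance : ∀ s v e → MinActive s v → nth (inc v) (ptr s v) ≡ just e →
           ¬ Admissible s v e → suc (ptr s v) ℕ.< d v →
           Step s ⟨ flow s , label s , upd (ptr s) v (suc (ptr s v)) ⟩
    relabel : ∀ s v e → MinActive s v → nth (inc v) (ptr s v) ≡ just e →
           ¬ Admissible s v e → suc (ptr s v) ≡ d v →
           Step s ⟨ flow s , upd (label s) v (suc (label s v)) , upd (ptr s) v 0 ⟩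

  initial : State G
  initial = ⟨ (λ _ → + 0) , (λ _ → 0) , (λ _ → 0) ⟩

  Reachable : State G → Set
  Reachable s = Star Step initial s

  Terminated : State G → Set
  Terminated s = ∀ v → ¬ Active s v

-- The proof rests on one invariant of every reachable state: each vertex
-- has supply at most w d(v), and each vertex of positive label has supply
-- at least d(v).  Initially this is the hypothesis Δ ≤ w d.  A push of ψ
-- from v to u keeps it because ψ ≤ ex(v) = f(v) − d(v) and
-- ψ ≤ w d(u) − f(u); a relabel only raises the label of an active vertex,
-- whose supply exceeds its degree.  At termination no vertex of label
-- below h has excess, i.e. its supply is at most its degree.
module Submission where

open import Defs
open import Data.Nat using (ℕ; _≤_; _<_; _∸_; _*_)
open import Data.Integer as ℤ using (+_)
open import Data.Fin using (Fin)
open import Data.Product using (_×_)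

open import Data.Nat using (suc; s≤s)
open import Data.Integer using (ℤ; 0ℤ; -_; _⊔_; _⊓_; +≤+; nonNegative)
import Data.Integer.Properties as ℤP
open import Data.Integer.Tactic.RingSolver using (solve-∀)
open import Algebra.Properties.CommutativeSemigroup ℤP.+-commutativeSemigroup
  using (xy∙z≈xz∙y)
open import Data.Fin using (_≟_)
open import Data.Product using (_,_; proj₁; proj₂)
open import Data.Sum using (_⊎_; inj₁; inj₂; [_,_])
open import Data.List using (List; _∷_; map)
open import Data.List.Properties using (map-cong-local)
open import Data.List.Membership.Propositional using (_∈_)
open import Data.List.Relation.Unary.Any using (here; there)
open import Data.List.Relation.Unary.All as All using (All; []; _∷_)
open import Data.List.Relation.Unary.Unique.Propositional using (Unique)
open import Data.List.Relation.Unary.AllPairs using (_∷_)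
open import Data.Maybe using (just)
open import Data.Bool using (true; false)
open import Function using (_∘_)
open import Function.Bundles using (Equivalence)
open import Relation.Nullary using (Dec; yes; no; ¬_; contradiction)
open import Relation.Nullary.Decidable using (⌊_⌋; isYes≗does; dec-true; dec-false)
open import Relation.Binary.PropositionalEquality
  using (_≡_; _≢_; refl; sym; trans; cong; cong₂; subst; ≢-sym; module ≡-Reasoning)
open import Relation.Binary.Construct.Closure.ReflexiveTransitive using (Star; ε; _◅_)

⌊⌋≡true : ∀ {A : Set} (a? : Dec A) → A → ⌊ a? ⌋ ≡ true
⌊⌋≡true a? a = trans (isYes≗does a?) (dec-true a? a)

⌊⌋≡false : ∀ {A : Set} (a? : Dec A) → ¬ A → ⌊ a? ⌋ ≡ false
⌊⌋≡false a? ¬a = trans (isYes≗does a?) (dec-false a? ¬a)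

nth-∈ : ∀ {A : Set} (xs : List A) k {x} → nth xs k ≡ just x → x ∈ xs
nth-∈ (x ∷ xs) 0       refl = here refl
nth-∈ (x ∷ xs) (suc k) p    = there (nth-∈ xs k p)

m≤n∸1⇒m<n : ∀ {m n} → 1 ≤ n → m ≤ n ∸ 1 → m < n
m≤n∸1⇒m<n {n = suc _} _ = s≤s

sumℤ-map-zero : ∀ {A : Set} {f : A → ℤ} {xs} → All (λ x → f x ≡ 0ℤ) xs →
                sumℤ (map f xs) ≡ 0ℤ
sumℤ-map-zero []         = refl
sumℤ-map-zero (fx≡0 ∷ ps) = cong₂ ℤ._+_ fx≡0 (sumℤ-map-zero ps)

sumℤ-map-update : ∀ {A : Set} {f g : A → ℤ} {x} {xs} (c : ℤ) →
                  Unique xs → x ∈ xs → (∀ y → y ≢ x → f y ≡ g y) →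
                  f x ≡ g x ℤ.+ c → sumℤ (map f xs) ≡ sumℤ (map g xs) ℤ.+ c
sumℤ-map-update {f = f} {g} {xs = x ∷ xs} c (x∉xs ∷ _) (here refl) f≡g fx≡gx+c =
  begin
    f x ℤ.+ sumℤ (map f xs)
  ≡⟨ cong₂ ℤ._+_ fx≡gx+c (cong sumℤ (map-cong-local (All.map (f≡g _ ∘ ≢-sym) x∉xs))) ⟩
    g x ℤ.+ c ℤ.+ sumℤ (map g xs)
  ≡⟨ xy∙z≈xz∙y (g x) c _ ⟩
    g x ℤ.+ sumℤ (map g xs) ℤ.+ c
  ∎
  where open ≡-Reasoning
sumℤ-map-update {f = f} {g} {xs = y ∷ xs} c (y∉xs ∷ xs!) (there x∈xs) f≡g fx≡gx+c =
  begin
    f y ℤ.+ sumℤ (map f xs)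
  ≡⟨ cong₂ ℤ._+_ (f≡g y (All.lookup y∉xs x∈xs)) (sumℤ-map-update c xs! x∈xs f≡g fx≡gx+c) ⟩
    g y ℤ.+ (sumℤ (map g xs) ℤ.+ c)
  ≡⟨ ℤP.+-assoc (g y) _ c ⟨
    g y ℤ.+ sumℤ (map g xs) ℤ.+ c
  ∎
  where open ≡-Reasoning

i≤j-k⇒k+i≤j : ∀ {i j k : ℤ} → i ℤ.≤ j ℤ.- k → k ℤ.+ i ℤ.≤ j
i≤j-k⇒k+i≤j {i} {j} {k} i≤j-k =
  ℤP.0≤i-j⇒j≤i (subst (0ℤ ℤ.≤_) (reorder j k i) (ℤP.i≤j⇒0≤j-i i≤j-k))
  where
  reorder : ∀ (j k i : ℤ) → j ℤ.- k ℤ.- i ≡ j ℤ.- (k ℤ.+ i)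
  reorder = solve-∀

i≤j-k⇒k≤j-i : ∀ {i j k : ℤ} → i ℤ.≤ j ℤ.- k → k ℤ.≤ j ℤ.- i
i≤j-k⇒k≤j-i {i} {j} {k} i≤j-k =
  ℤP.0≤i-j⇒j≤i (subst (0ℤ ℤ.≤_) (reorder j k i) (ℤP.i≤j⇒0≤j-i i≤j-k))
  where
  reorder : ∀ (j k i : ℤ) → j ℤ.- k ℤ.- i ≡ j ℤ.- i ℤ.- k
  reorder = solve-∀

i⊔0>0⇒i⊔0≡i : ∀ i → 0ℤ ℤ.< i ⊔ 0ℤ → i ⊔ 0ℤ ≡ i
i⊔0>0⇒i⊔0≡i i 0<i⊔0 with ℤP.⊔-sel i 0ℤ
... | inj₁ i⊔0≡i = i⊔0≡i
... | inj₂ i⊔0≡0 = contradiction (subst (0ℤ ℤ.<_) i⊔0≡0 0<i⊔0) (ℤP.<-irrefl refl)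

module UnitFlowInvariant (G : Graph) (Δ : Fin (Graph.n G) → ℕ) (U h w : ℕ) where
  open Graph G
  open UnitFlow G Δ U h w
  open State

  isTail-tail : ∀ e → isTail (proj₁ (ends e)) e ≡ true
  isTail-tail e = ⌊⌋≡true (proj₁ (ends e) ≟ proj₁ (ends e)) refl

  isTail-head : ∀ e → isTail (proj₂ (ends e)) e ≡ false
  isTail-head e = ⌊⌋≡false (proj₂ (ends e) ≟ proj₁ (ends e)) (loopless e ∘ sym)

  other-tail : ∀ e → other (proj₁ (ends e)) e ≡ proj₂ (ends e)
  other-tail e rewrite isTail-tail e = refl

  other-head : ∀ e → other (proj₂ (ends e)) e ≡ proj₁ (ends e)
  other-head e rewrite isTail-head e = refl

  endpoint : ∀ {v e} → e ∈ inc v → v ≡ proj₁ (ends e) ⊎ v ≡ proj₂ (ends e)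
  endpoint {v} {e} = Equivalence.to (inc-complete v e)

  other-∈ : ∀ {v e} → e ∈ inc v → e ∈ inc (other v e)
  other-∈ {v} {e} e∈v with endpoint e∈v
  ... | inj₁ refl = Equivalence.from (inc-complete _ e) (inj₂ (other-tail e))
  ... | inj₂ refl = Equivalence.from (inc-complete _ e) (inj₁ (other-head e))

  ∈-inc-endpoints : ∀ {v x e} → e ∈ inc v → e ∈ inc x → x ≡ v ⊎ x ≡ other v e
  ∈-inc-endpoints {e = e} e∈v e∈x with endpoint e∈v | endpoint e∈x
  ... | inj₁ refl | inj₁ x≡v = inj₁ x≡v
  ... | inj₁ refl | inj₂ x≡u = inj₂ (trans x≡u (sym (other-tail e)))
  ... | inj₂ refl | inj₁ x≡u = inj₂ (trans x≡u (sym (other-head e)))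
  ... | inj₂ refl | inj₂ x≡v = inj₁ x≡v

  flowFrom-antisym : ∀ s {v e} → e ∈ inc v → flowFrom s (other v e) e ≡ - flowFrom s v e
  flowFrom-antisym s {e = e} e∈v with endpoint e∈v
  ... | inj₁ refl rewrite other-tail e | isTail-head e | isTail-tail e = refl
  ... | inj₂ refl rewrite other-head e | isTail-tail e | isTail-head e =
    sym (ℤP.neg-involutive (flow s e))

  supply-initial : ∀ v → supply initial v ≡ + Δ v
  supply-initial v =
    trans (cong (ℤ._+_ (+ Δ v))
                (sumℤ-map-zero {xs = inc v} (All.tabulate (λ {e} _ → no-flow e))))
          (ℤP.+-identityʳ (+ Δ v))
    where
    no-flow : ∀ e → - flowFrom initial v e ≡ 0ℤ
    no-flow e with isTail v e
    ... | true  = refl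
    ... | false = refl

  supply-update : ∀ s t {x e} (c : ℤ) → e ∈ inc x →
                  (∀ e′ → e′ ≢ e → flowFrom t x e′ ≡ flowFrom s x e′) →
                  - flowFrom t x e ≡ - flowFrom s x e ℤ.+ c →
                  supply t x ≡ supply s x ℤ.+ c
  supply-update s t {x} c e∈x same changed =
    trans (cong (ℤ._+_ (+ Δ x))
                (sumℤ-map-update c (inc-unique x) e∈x (λ e′ → cong -_ ∘ same e′) changed))
          (sym (ℤP.+-assoc (+ Δ x) (sumℤ (map (λ e′ → - flowFrom s x e′) (inc x))) c))

  supply-cong : ∀ s t {x} → (∀ {e} → e ∈ inc x → flowFrom t x e ≡ flowFrom s x e) →
                supply t x ≡ supply s x
  supply-cong s t {x} same =
    cong (λ fs → + Δ x ℤ.+ sumℤ fs) (map-cong-local (All.tabulate (cong -_ ∘ same)))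

  push-state : State G → Fin n → Fin m → ℤ → State G
  push-state s v e ψ = ⟨ addFlow s v e ψ , label s , ptr s ⟩

  module Push (s : State G) (v : Fin n) (e : Fin m) (ψ : ℤ) (e∈v : e ∈ inc v) where

    pushed : State G
    pushed = push-state s v e ψ

    u : Fin n
    u = other v e

    flowFrom-pushed : flowFrom pushed v e ≡ flowFrom s v e ℤ.+ ψ
    flowFrom-pushed rewrite ⌊⌋≡true (e ≟ e) refl with isTail v e
    ... | true  = refl
    ... | false = flip-sign (flow s e) ψ
      where
      flip-sign : ∀ (a b : ℤ) → - (a ℤ.- b) ≡ - a ℤ.+ b
      flip-sign = solve-∀

    flowFrom-unpushed : ∀ x e′ → e′ ≢ e → flowFrom pushed x e′ ≡ flowFrom s x e′
    flowFrom-unpushed x e′ e′≢e rewrite ⌊⌋≡false (e′ ≟ e) e′≢e = refl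

    supply-source : supply pushed v ≡ supply s v ℤ.- ψ
    supply-source = supply-update s pushed (- ψ) e∈v (flowFrom-unpushed v)
      (trans (cong -_ flowFrom-pushed) (ℤP.neg-distrib-+ (flowFrom s v e) ψ))

    supply-target : supply pushed u ≡ supply s u ℤ.+ ψ
    supply-target = supply-update s pushed ψ (other-∈ e∈v) (flowFrom-unpushed u) received
      where
      open ≡-Reasoning
      received : - flowFrom pushed u e ≡ - flowFrom s u e ℤ.+ ψ
      received = begin
        - flowFrom pushed u e      ≡⟨ cong -_ (flowFrom-antisym pushed e∈v) ⟩
        - - flowFrom pushed v e    ≡⟨ ℤP.neg-involutive _ ⟩
        flowFrom pushed v e        ≡⟨ flowFrom-pushed ⟩
        flowFrom s v e ℤ.+ ψ       ≡⟨ cong (ℤ._+ ψ) (ℤP.neg-involutive (flowFrom s v e)) ⟨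
        - - flowFrom s v e ℤ.+ ψ   ≡⟨ cong (λ z → - z ℤ.+ ψ) (flowFrom-antisym s e∈v) ⟨
        - flowFrom s u e ℤ.+ ψ     ∎

    supply-elsewhere : ∀ x → x ≢ v → x ≢ u → supply pushed x ≡ supply s x
    supply-elsewhere x x≢v x≢u = supply-cong s pushed (λ {e′} e′∈x →
      flowFrom-unpushed x e′ (λ { refl → [ x≢v , x≢u ] (∈-inc-endpoints e∈v e′∈x) }))

  Invariant : State G → Set
  Invariant s = ∀ v → (supply s v ℤ.≤ + (w * d v))
                    × (1 ≤ label s v → + d v ℤ.≤ supply s v)

  invariant-initial : (∀ v → Δ v ≤ w * d v) → Invariant initial
  invariant-initial Δ≤wd v =
    subst (ℤ._≤ + (w * d v)) (sym (supply-initial v)) (+≤+ (Δ≤wd v)) , λ ()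

  active⇒d≤supply : ∀ s v → Active s v → + d v ℤ.≤ supply s v
  active⇒d≤supply s v (_ , 0<ex) =
    ℤP.0≤i-j⇒j≤i (ℤP.<⇒≤ (subst (0ℤ ℤ.<_) (i⊔0>0⇒i⊔0≡i _ 0<ex) 0<ex))

  push-invariant : ∀ s v e ψ (e∈v : e ∈ inc v) → Invariant s →
                   0ℤ ℤ.≤ ψ → ψ ℤ.≤ supply s v ℤ.- + d v →
                   ψ ℤ.≤ + (w * d (other v e)) ℤ.- supply s (other v e) →
                   Invariant (push-state s v e ψ)
  push-invariant s v e ψ e∈v I 0≤ψ ψ≤ex ψ≤room x with x ≟ v | x ≟ other v e
  ... | yes refl | _ rewrite Push.supply-source s v e ψ e∈v =
        ℤP.≤-trans (ℤP.i≤j⇒i-k≤j ψ {{nonNegative 0≤ψ}} ℤP.≤-refl) (proj₁ (I v))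
      , λ _ → i≤j-k⇒k≤j-i {j = supply s v} ψ≤ex
  ... | no _ | yes refl rewrite Push.supply-target s v e ψ e∈v =
        i≤j-k⇒k+i≤j {k = supply s x} ψ≤room
      , λ 1≤l → ℤP.≤-trans (proj₂ (I x) 1≤l) (ℤP.i≤i+j _ ψ {{nonNegative 0≤ψ}})
  ... | no x≢v | no x≢u rewrite Push.supply-elsewhere s v e ψ e∈v x x≢v x≢u = I x

  step-invariant : ∀ {s t} → Invariant s → Step s t → Invariant t
  step-invariant I (push s v e (active , _) nth≡e (0<res , _)) =
    push-invariant s v e ψ e∈v I
      (ℤP.⊓-glb (ℤP.<⇒≤ (proj₂ active))
                (ℤP.⊓-glb (ℤP.<⇒≤ 0<res) (ℤP.i≤j⇒0≤j-i (proj₁ (I (other v e))))))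
      (subst (ψ ℤ.≤_) (i⊔0>0⇒i⊔0≡i _ (proj₂ active)) (ℤP.i⊓j≤i (ex s v) _))
      (ℤP.≤-trans (ℤP.i⊓j≤j _ _) (ℤP.i⊓j≤j _ _))
    where
    ψ : ℤ
    ψ = ex s v ⊓ (res s v e ⊓ (+ (w * d (other v e)) ℤ.- supply s (other v e)))
    e∈v : e ∈ inc v
    e∈v = nth-∈ (inc v) (ptr s v) nth≡e
  step-invariant I (advance _ _ _ _ _ _ _) = I
  step-invariant I (relabel s v _ (active , _) _ _ _) x = proj₁ (I x) , lower
    where
    lower : 1 ≤ upd (label s) v (suc (label s v)) x → + d x ℤ.≤ supply s x
    lower with x ≟ v
    ... | yes refl = λ _ → active⇒d≤supply s v active
    ... | no _     = proj₂ (I x)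

  reachable-invariant : (∀ v → Δ v ≤ w * d v) → ∀ {s} → Reachable s → Invariant s
  reachable-invariant Δ≤wd = go (invariant-initial Δ≤wd)
    where
    go : ∀ {s t} → Invariant s → Star Step s t → Invariant t
    go I ε          = I
    go I (st ◅ sts) = go (step-invariant I st) sts

  terminated⇒supply≤d : ∀ s v → Terminated s → label s v < h → supply s v ℤ.≤ + d v
  terminated⇒supply≤d s v T l<h =
    ℤP.i-j≤0⇒i≤j (ℤP.≤-trans (ℤP.i≤i⊔j _ 0ℤ) (ℤP.≮⇒≥ (λ 0<ex → T v (l<h , 0<ex))))

lemma10 : (G : Graph) (Δ : Fin (Graph.n G) → ℕ) (U h w : ℕ) →
          0 < U → 1 ≤ h → 2 ≤ w →
          (∀ v → Δ v ≤ w * UnitFlow.d G Δ U h w v) →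
          (s : State G) → UnitFlow.Reachable G Δ U h w s →
          UnitFlow.Terminated G Δ U h w s →
          ∀ v →
            (State.label s v ≡ h →
               (UnitFlow.supply G Δ U h w s v ℤ.≤ + (w * UnitFlow.d G Δ U h w v))
               × (+ UnitFlow.d G Δ U h w v ℤ.≤ UnitFlow.supply G Δ U h w s v))
          × (1 ≤ State.label s v → State.label s v ≤ h ∸ 1 →
               (UnitFlow.supply G Δ U h w s v ℤ.≤ + (w * UnitFlow.d G Δ U h w v))
               × (UnitFlow.supply G Δ U h w s v ≡ + UnitFlow.d G Δ U h w v))
          × (State.label s v ≡ 0 →
               UnitFlow.supply G Δ U h w s v ℤ.≤ + UnitFlow.d G Δ U h w v)
lemma10 G Δ U h w _ 1≤h _ Δ≤wd s R T v =
    (λ { refl → proj₁ (I v) , proj₂ (I v) 1≤h })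
  , (λ 1≤l l≤h-1 → proj₁ (I v)
                 , ℤP.≤-antisym (settled (m≤n∸1⇒m<n 1≤h l≤h-1)) (proj₂ (I v) 1≤l))
  , (λ { l≡0 → settled (subst (_< h) (sym l≡0) 1≤h) })
  where
  open UnitFlow G Δ U h w
  open UnitFlowInvariant G Δ U h w
  I : Invariant s
  I = reachable-invariant Δ≤wd R
  settled : State.label s v < h → supply s v ℤ.≤ + d v
  settled = terminated⇒supply≤d s v T
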